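{- Let $n_1,\dots,n_k$ be positive integers, $L=\operatorname{lcm}(n_1,\dots,n_k)$, and $A=\prod_{j=1}^k\mathbb{Z}/n_j\mathbb{Z}$. Then $$\frac1L\sum_{l=1}^{L}\gcd(l,n_1)\gcd(l,n_2)\cdots\gcd(l,n_k)=\sum_{a\in A}\frac{1}{|a|},$$ where $|a|$ denotes the order of the element $a\in A$. (Every finite abelian group is of this form, so this holds for every finite abelian group $A$.) -}

module Defs where

open import Data.Nat using (ℕ; zero; suc; _*_; _<_; _≤_)
open import Data.Nat.Divisibility using (_∣_)
open import Data.Nat.ListAction using (product)
open import Data.Unit using (⊤)
open import Data.Product using (_×_)
open import Data.Nat.GCD using (gcd)
open import Data.Nat.LCM using (lcm)
open import Data.Fin using (Fin; toℕ)
open import Data.List using (List; []; _∷_; map; concatMap; applyUpTo; foldr; allFin)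
open import Data.List.Relation.Unary.All using (All; []; _∷_)
open import Data.Integer using (+_)
open import Data.Rational using (ℚ; 0ℚ; _/_; _+_)

-- The group A = ∏_j ℤ/n_jℤ for a list ns = [n_1,…,n_k] of moduli.
-- An element is a tuple (a_1,…,a_k) with a_j ∈ Fin n_j ≅ ℤ/n_jℤ
-- (a_j represented by its residue 0 ≤ a_j < n_j).
Grp : List ℕ → Set
Grp ns = All Fin ns

elems : (ns : List ℕ) → List (Grp ns)
elems []       = [] ∷ []
elems (n ∷ ns) = concatMap (λ x → map (x ∷_) (elems ns)) (allFin n)

MulZero : (ns : List ℕ) → ℕ → Grp ns → Set
MulZero []       m []       = ⊤
MulZero (n ∷ ns) m (x ∷ a)  = (n ∣ m * toℕ x) × MulZero ns m a

IsOrder : (ns : List ℕ) → Grp ns → ℕ → Set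
IsOrder ns a o = (0 < o) × MulZero ns o a × (∀ m → 0 < m → MulZero ns m a → o ≤ m)

sumℚ : List ℚ → ℚ
sumℚ = foldr _+_ 0ℚ

-- 1/m as a rational (only used for m > 0; value 0 at m = 0 is irrelevant).
inv : ℕ → ℚ
inv zero    = 0ℚ
inv (suc m) = + 1 / suc m

lcmList : List ℕ → ℕ
lcmList = foldr lcm 1

gcdProd : ℕ → List ℕ → ℕ
gcdProd l ns = product (map (gcd l) ns)

lhsSum : List ℕ → ℚ
lhsSum ns = sumℚ (applyUpTo (λ i → + gcdProd (suc i) ns / 1) (lcmList ns))

-- Count the pairs (l, a) with 1 ≤ l ≤ L and l·a = 0 in two ways. For fixed l, the
-- solutions of l·x = 0 in ℤ/nℤ are the multiples of n / gcd(l, n), of which there are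
-- gcd(l, n); so the kernel of multiplication by l on A has ∏ⱼ gcd(l, nⱼ) elements. For
-- fixed a, l·a = 0 exactly when |a| divides l, and |a| divides L, so there are L / |a|
-- such l. Hence Σₗ ∏ⱼ gcd(l, nⱼ) = Σₐ L / |a|.
module Submission where

open import Defs
open import Data.List using (List; []; _∷_; map; applyUpTo)
open import Data.List.Properties using (map-cong)
open import Data.List.Relation.Unary.All using (All)
open import Data.Product using (_,_; proj₁)
open import Relation.Binary.PropositionalEquality using (_≡_; refl; sym; trans; cong; cong₂; module ≡-Reasoning)
open import Function using (_∘_)

module Counting where

  open import Level using (Level)
  open import Function using (_⇔_; mk⇔; Equivalence)
  open import Data.Nat
  open import Data.Nat.Properties
  open import Algebra.Properties.CommutativeSemigroup +-commutativeSemigroup using (interchange)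
  open import Data.Nat.Divisibility
  open import Data.Nat.DivMod using (m≡m%n+[m/n]*n; m%n<n)
  open import Data.Nat.GCD using (gcd; gcd[m,n]∣m; gcd[m,n]∣n; gcd[m,n]≢0)
  open import Data.Nat.LCM using (lcm; m∣lcm[m,n]; n∣lcm[m,n]; gcd*lcm)
  open import Data.Nat.Coprimality as Coprimality using (Coprime; coprime-divisor; coprime-/gcd)
  open import Data.Nat.ListAction using (sum)
  open import Data.Nat.ListAction.Properties using (sum-++)
  open import Data.List using (_++_; _∷ʳ_; concatMap; upTo; allFin; tabulate; [_])
  open import Data.List.Properties using (map-++; map-∘; map-tabulate; applyUpTo-∷ʳ; map-upTo)
  open import Data.List.Relation.Unary.All using ([]; _∷_)
  open import Data.Fin using (toℕ)
  open import Data.Sum using (inj₂)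
  open import Data.Unit using (tt)
  open import Relation.Nullary using (Dec; yes; no; ¬_; contradiction; _×-dec_)
  open import Relation.Binary.PropositionalEquality using (subst; subst₂)
  open Equivalence using (to; from)
  open ≡-Reasoning

  variable
    a b : Level
    A P : Set a
    B Q : Set b

  𝟙 : Dec P → ℕ
  𝟙 (yes _) = 1
  𝟙 (no _)  = 0

  𝟙-yes : (P? : Dec P) → P → 𝟙 P? ≡ 1
  𝟙-yes (yes _) _ = refl
  𝟙-yes (no ¬p) p = contradiction p ¬p

  𝟙-no : (P? : Dec P) → ¬ P → 𝟙 P? ≡ 0
  𝟙-no (yes p) ¬p = contradiction p ¬p
  𝟙-no (no _)  _  = refl

  𝟙-cong : (P? : Dec P) (Q? : Dec Q) → P ⇔ Q → 𝟙 P? ≡ 𝟙 Q?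
  𝟙-cong (yes p) Q? P⇔Q = sym (𝟙-yes Q? (to P⇔Q p))
  𝟙-cong (no ¬p) Q? P⇔Q = sym (𝟙-no Q? (¬p ∘ from P⇔Q))

  𝟙-× : (P? : Dec P) (Q? : Dec Q) → 𝟙 (P? ×-dec Q?) ≡ 𝟙 P? * 𝟙 Q?
  𝟙-× (yes _) (yes _) = refl
  𝟙-× (yes _) (no _)  = refl
  𝟙-× (no _)  _       = refl

  sum-map-+ : (f g : A → ℕ) (xs : List A) →
              sum (map (λ x → f x + g x) xs) ≡ sum (map f xs) + sum (map g xs)
  sum-map-+ f g []       = refl
  sum-map-+ f g (x ∷ xs) = trans (cong (f x + g x +_) (sum-map-+ f g xs)) (interchange (f x) (g x) _ _)

  sum-map-zero : (xs : List A) → sum (map (λ _ → 0) xs) ≡ 0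
  sum-map-zero []       = refl
  sum-map-zero (_ ∷ xs) = sum-map-zero xs

  sum-map-comm : (f : A → B → ℕ) (xs : List A) (ys : List B) →
                 sum (map (λ x → sum (map (f x) ys)) xs) ≡ sum (map (λ y → sum (map (λ x → f x y) xs)) ys)
  sum-map-comm f []       ys = sym (sum-map-zero ys)
  sum-map-comm f (x ∷ xs) ys =
    trans (cong (sum (map (f x) ys) +_) (sum-map-comm f xs ys)) (sym (sum-map-+ (f x) _ ys))

  sum-map-*ˡ : ∀ c (f : A → ℕ) xs → sum (map (λ x → c * f x) xs) ≡ c * sum (map f xs)
  sum-map-*ˡ c f []       = sym (*-zeroʳ c)
  sum-map-*ˡ c f (x ∷ xs) = trans (cong (c * f x +_) (sum-map-*ˡ c f xs)) (sym (*-distribˡ-+ c (f x) _))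

  sum-map-*ʳ : ∀ c (f : A → ℕ) xs → sum (map (λ x → f x * c) xs) ≡ sum (map f xs) * c
  sum-map-*ʳ c f xs = begin
    sum (map (λ x → f x * c) xs) ≡⟨ cong sum (map-cong (λ x → *-comm (f x) c) xs) ⟩
    sum (map (λ x → c * f x) xs) ≡⟨ sum-map-*ˡ c f xs ⟩
    c * sum (map f xs)           ≡⟨ *-comm c _ ⟩
    sum (map f xs) * c           ∎

  sum-map-concatMap : (f : B → ℕ) (g : A → List B) (xs : List A) →
                      sum (map f (concatMap g xs)) ≡ sum (map (λ x → sum (map f (g x))) xs)
  sum-map-concatMap f g []       = refl
  sum-map-concatMap f g (x ∷ xs) = begin
    sum (map f (g x ++ concatMap g xs))
      ≡⟨ cong sum (map-++ f (g x) (concatMap g xs)) ⟩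
    sum (map f (g x) ++ map f (concatMap g xs))
      ≡⟨ sum-++ (map f (g x)) _ ⟩
    sum (map f (g x)) + sum (map f (concatMap g xs))
      ≡⟨ cong (sum (map f (g x)) +_) (sum-map-concatMap f g xs) ⟩
    sum (map (λ x → sum (map f (g x))) (x ∷ xs)) ∎

  ∑< : ℕ → (ℕ → ℕ) → ℕ
  ∑< n f = sum (applyUpTo f n)

  ∑<-cong : ∀ n {f g : ℕ → ℕ} → (∀ i → f i ≡ g i) → ∑< n f ≡ ∑< n g
  ∑<-cong zero    f≗g = refl
  ∑<-cong (suc n) f≗g = cong₂ _+_ (f≗g 0) (∑<-cong n (f≗g ∘ suc))

  ∑<-vanishes : ∀ n {f : ℕ → ℕ} → (∀ i → i < n → f i ≡ 0) → ∑< n f ≡ 0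
  ∑<-vanishes zero    _   = refl
  ∑<-vanishes (suc n) f≡0 = cong₂ _+_ (f≡0 0 z<s) (∑<-vanishes n (λ i i<n → f≡0 (suc i) (s<s i<n)))

  ∑<-+ : ∀ m n (f : ℕ → ℕ) → ∑< (m + n) f ≡ ∑< m f + ∑< n (λ i → f (m + i))
  ∑<-+ zero    n f = refl
  ∑<-+ (suc m) n f = trans (cong (f 0 +_) (∑<-+ m n (f ∘ suc))) (sym (+-assoc (f 0) _ _))

  ∑<-suc : ∀ n (f : ℕ → ℕ) → ∑< (suc n) f ≡ ∑< n f + f n
  ∑<-suc n f = begin
    sum (applyUpTo f (suc n))      ≡⟨ cong sum (applyUpTo-∷ʳ f n) ⟨
    sum (applyUpTo f n ∷ʳ f n)     ≡⟨ sum-++ (applyUpTo f n) [ f n ] ⟩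
    ∑< n f + (f n + 0)             ≡⟨ cong (∑< n f +_) (+-identityʳ (f n)) ⟩
    ∑< n f + f n                   ∎

  ∑<-rotate : ∀ n (f : ℕ → ℕ) → f n ≡ f 0 → ∑< n (f ∘ suc) ≡ ∑< n f
  ∑<-rotate n f fn≡f0 = +-cancelˡ-≡ (f 0) _ _ (begin
    f 0 + ∑< n (f ∘ suc) ≡⟨ ∑<-suc n f ⟩
    ∑< n f + f n         ≡⟨ cong (∑< n f +_) fn≡f0 ⟩
    ∑< n f + f 0         ≡⟨ +-comm (∑< n f) (f 0) ⟩
    f 0 + ∑< n f         ∎)

  ∑<-sum-comm : ∀ n (f : ℕ → A → ℕ) xs →
                ∑< n (λ i → sum (map (f i) xs)) ≡ sum (map (λ x → ∑< n (λ i → f i x)) xs)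
  ∑<-sum-comm n f xs = begin
    ∑< n (λ i → sum (map (f i) xs))
      ≡⟨ cong sum (map-upTo _ n) ⟨
    sum (map (λ i → sum (map (f i) xs)) (upTo n))
      ≡⟨ sum-map-comm f (upTo n) xs ⟩
    sum (map (λ x → sum (map (λ i → f i x) (upTo n))) xs)
      ≡⟨ cong sum (map-cong (λ x → cong sum (map-upTo (λ i → f i x) n)) xs) ⟩
    sum (map (λ x → ∑< n (λ i → f i x)) xs) ∎

  tabulate∘toℕ : ∀ n (f : ℕ → A) → tabulate (f ∘ toℕ {n}) ≡ applyUpTo f n
  tabulate∘toℕ zero    f = refl
  tabulate∘toℕ (suc n) f = cong (f 0 ∷_) (tabulate∘toℕ n (f ∘ suc))

  sum-map-allFin : ∀ n (f : ℕ → ℕ) → sum (map (f ∘ toℕ) (allFin n)) ≡ ∑< n f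
  sum-map-allFin n f = cong sum (trans (map-tabulate (λ i → i) (f ∘ toℕ)) (tabulate∘toℕ n f))

  one-multiple-per-period : ∀ d .{{_ : NonZero d}} → ∑< d (λ i → 𝟙 (d ∣? i)) ≡ 1
  one-multiple-per-period d@(suc d-1) =
    cong₂ _+_ (𝟙-yes (d ∣? 0) (d ∣0))
              (∑<-vanishes d-1 (λ i i<d-1 → 𝟙-no (d ∣? suc i) (>⇒∤ (s<s i<d-1))))

  count-multiples : ∀ d .{{_ : NonZero d}} q → ∑< (q * d) (λ i → 𝟙 (d ∣? i)) ≡ q
  count-multiples d zero    = refl
  count-multiples d (suc q) = begin
    ∑< (d + q * d) χ                       ≡⟨ ∑<-+ d (q * d) χ ⟩
    ∑< d χ + ∑< (q * d) (λ i → χ (d + i))  ≡⟨ cong₂ _+_ (one-multiple-per-period d) (∑<-cong (q * d) periodic) ⟩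
    1 + ∑< (q * d) χ                       ≡⟨ cong suc (count-multiples d q) ⟩
    suc q                                  ∎
    where
      χ : ℕ → ℕ
      χ i = 𝟙 (d ∣? i)
      periodic : ∀ i → χ (d + i) ≡ χ i
      periodic i = 𝟙-cong (d ∣? d + i) (d ∣? i) (mk⇔ (λ d∣d+i → ∣m+n∣m⇒∣n d∣d+i ∣-refl) (∣m∣n⇒∣m+n ∣-refl))

  count-positive-multiples : ∀ d .{{_ : NonZero d}} q → ∑< (q * d) (λ i → 𝟙 (d ∣? suc i)) ≡ q
  count-positive-multiples d q =
    trans (∑<-rotate (q * d) (λ i → 𝟙 (d ∣? i)) (trans (𝟙-yes _ (n∣m*n q)) (sym (𝟙-yes _ (d ∣0)))))
          (count-multiples d q)

  coprime⇒[g*d∣g*l*i⇔d∣i] : ∀ g {d l i} .{{_ : NonZero g}} → Coprime d l → g * d ∣ g * l * i ⇔ d ∣ i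
  coprime⇒[g*d∣g*l*i⇔d∣i] g {d} {l} {i} d⊥l = mk⇔
    (λ gd∣gli → coprime-divisor d⊥l (*-cancelˡ-∣ g (subst (g * d ∣_) (*-assoc g l i) gd∣gli)))
    (λ d∣i → subst (g * d ∣_) (sym (*-assoc g l i)) (*-monoʳ-∣ g (∣n⇒∣m*n l d∣i)))

  count-gcd : ∀ n .{{_ : NonZero n}} l → ∑< n (λ i → 𝟙 (n ∣? l * i)) ≡ gcd l n
  count-gcd n l = begin
    ∑< n (λ i → 𝟙 (n ∣? l * i))    ≡⟨ ∑<-cong n (λ i → 𝟙-cong _ _ (n∣l*i⇔d∣i i)) ⟩
    ∑< n (λ i → 𝟙 (d ∣? i))        ≡⟨ cong (λ k → ∑< k (λ i → 𝟙 (d ∣? i))) n≡g*d ⟩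
    ∑< (g * d) (λ i → 𝟙 (d ∣? i))  ≡⟨ count-multiples d g ⟩
    g                              ∎
    where
      g : ℕ
      g = gcd l n
      g∣l : g ∣ l
      g∣l = gcd[m,n]∣m l n
      g∣n : g ∣ n
      g∣n = gcd[m,n]∣n l n
      d l′ : ℕ
      d = quotient g∣n
      l′ = quotient g∣l
      n≡g*d : n ≡ g * d
      n≡g*d = m∣n⇒n≡m*quotient g∣n
      instance
        g≢0 : NonZero g
        g≢0 = ≢-nonZero (gcd[m,n]≢0 l n (inj₂ (≢-nonZero⁻¹ n)))
        d≢0 : NonZero d
        d≢0 = quotient≢0 g∣n
      d⊥l′ : Coprime d l′
      d⊥l′ = Coprimality.sym (subst₂ Coprime (n/m≡quotient g∣l) (n/m≡quotient g∣n) (coprime-/gcd l n))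
      n∣l*i⇔d∣i : ∀ i → n ∣ l * i ⇔ d ∣ i
      n∣l*i⇔d∣i i = subst₂ (λ x y → x ∣ y * i ⇔ d ∣ i) (sym n≡g*d) (sym (m∣n⇒n≡m*quotient g∣l))
                          (coprime⇒[g*d∣g*l*i⇔d∣i] g d⊥l′)

  MulZero? : ∀ ns m (a : Grp ns) → Dec (MulZero ns m a)
  MulZero? []       m []      = yes tt
  MulZero? (n ∷ ns) m (x ∷ a) = (n ∣? m * toℕ x) ×-dec MulZero? ns m a

  MulZero-∣ : ∀ ns {m m′} (a : Grp ns) → m ∣ m′ → MulZero ns m a → MulZero ns m′ a
  MulZero-∣ []       []      _ _ = tt
  MulZero-∣ (n ∷ ns) (x ∷ a) m∣m′ (n∣mx , m·a≡0) = ∣-trans n∣mx (*-monoˡ-∣ (toℕ x) m∣m′) , MulZero-∣ ns a m∣m′ m·a≡0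

  MulZero-+⁻ˡ : ∀ ns {m m′} (a : Grp ns) → MulZero ns (m + m′) a → MulZero ns m′ a → MulZero ns m a
  MulZero-+⁻ˡ []       []      _ _ = tt
  MulZero-+⁻ˡ (n ∷ ns) {m} {m′} (x ∷ a) (n∣[m+m′]x , mm′·a≡0) (n∣m′x , m′·a≡0) =
    ∣m+n∣m⇒∣n (subst (n ∣_) (trans (*-distribʳ-+ (toℕ x) m m′) (+-comm (m * toℕ x) _)) n∣[m+m′]x) n∣m′x ,
    MulZero-+⁻ˡ ns a mm′·a≡0 m′·a≡0

  MulZero-lcmList : ∀ ns (a : Grp ns) → MulZero ns (lcmList ns) a
  MulZero-lcmList []       []      = tt
  MulZero-lcmList (n ∷ ns) (x ∷ a) =
    ∣-trans (m∣lcm[m,n] n (lcmList ns)) (m∣m*n (toℕ x)) ,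
    MulZero-∣ ns a (n∣lcm[m,n] n (lcmList ns)) (MulZero-lcmList ns a)

  below-order⇒≡0 : ∀ ns {a o} r → IsOrder ns a o → r < o → MulZero ns r a → r ≡ 0
  below-order⇒≡0 ns zero    _                 _   _      = refl
  below-order⇒≡0 ns (suc r) (_ , _ , minimal) r<o r·a≡0 = contradiction (minimal (suc r) z<s r·a≡0) (<⇒≱ r<o)

  order-∣ : ∀ ns {a o m} → IsOrder ns a o → MulZero ns m a → o ∣ m
  order-∣ ns {a} {o} {m} isOrder@(o>0 , o·a≡0 , _) m·a≡0 =
    m%n≡0⇒n∣m m o (below-order⇒≡0 ns (m % o) isOrder (m%n<n m o) [m%o]·a≡0)
    where
      instance
        o≢0 : NonZero o
        o≢0 = >-nonZero o>0
      [m%o]·a≡0 : MulZero ns (m % o) a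
      [m%o]·a≡0 = MulZero-+⁻ˡ ns a (subst (λ k → MulZero ns k a) (m≡m%n+[m/n]*n m o) m·a≡0)
                                   (MulZero-∣ ns a (n∣m*n (m / o)) o·a≡0)

  MulZero⇔order-∣ : ∀ ns {a o m} → IsOrder ns a o → MulZero ns m a ⇔ o ∣ m
  MulZero⇔order-∣ ns {a} isOrder@(_ , o·a≡0 , _) = mk⇔ (order-∣ ns isOrder) (λ o∣m → MulZero-∣ ns a o∣m o·a≡0)

  kernel-size : ∀ ns → All (0 <_) ns → ∀ l → sum (map (λ a → 𝟙 (MulZero? ns l a)) (elems ns)) ≡ gcdProd l ns
  kernel-size []       []           l = refl
  kernel-size (n ∷ ns) (n>0 ∷ ns>0) l = begin
    sum (map χ (concatMap (λ x → map (x ∷_) (elems ns)) (allFin n)))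
      ≡⟨ sum-map-concatMap χ (λ x → map (x ∷_) (elems ns)) (allFin n) ⟩
    sum (map (λ x → sum (map χ (map (x ∷_) (elems ns)))) (allFin n))
      ≡⟨ cong sum (map-cong fibre (allFin n)) ⟩
    sum (map (λ x → 𝟙 (n ∣? l * toℕ x) * gcdProd l ns) (allFin n))
      ≡⟨ sum-map-*ʳ (gcdProd l ns) (λ x → 𝟙 (n ∣? l * toℕ x)) (allFin n) ⟩
    sum (map (λ x → 𝟙 (n ∣? l * toℕ x)) (allFin n)) * gcdProd l ns
      ≡⟨ cong (_* gcdProd l ns) (sum-map-allFin n (λ i → 𝟙 (n ∣? l * i))) ⟩
    ∑< n (λ i → 𝟙 (n ∣? l * i)) * gcdProd l ns
      ≡⟨ cong (_* gcdProd l ns) (count-gcd n {{>-nonZero n>0}} l) ⟩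
    gcd l n * gcdProd l ns ∎
    where
      χ : Grp (n ∷ ns) → ℕ
      χ a = 𝟙 (MulZero? (n ∷ ns) l a)
      fibre : ∀ x → sum (map χ (map (x ∷_) (elems ns))) ≡ 𝟙 (n ∣? l * toℕ x) * gcdProd l ns
      fibre x = begin
        sum (map χ (map (x ∷_) (elems ns)))
          ≡⟨ cong sum (map-∘ (elems ns)) ⟨
        sum (map (λ a → 𝟙 ((n ∣? l * toℕ x) ×-dec MulZero? ns l a)) (elems ns))
          ≡⟨ cong sum (map-cong (λ a → 𝟙-× (n ∣? l * toℕ x) (MulZero? ns l a)) (elems ns)) ⟩
        sum (map (λ a → 𝟙 (n ∣? l * toℕ x) * 𝟙 (MulZero? ns l a)) (elems ns))
          ≡⟨ sum-map-*ˡ (𝟙 (n ∣? l * toℕ x)) (λ a → 𝟙 (MulZero? ns l a)) (elems ns) ⟩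
        𝟙 (n ∣? l * toℕ x) * sum (map (λ a → 𝟙 (MulZero? ns l a)) (elems ns))
          ≡⟨ cong (𝟙 (n ∣? l * toℕ x) *_) (kernel-size ns ns>0 l) ⟩
        𝟙 (n ∣? l * toℕ x) * gcdProd l ns ∎

  count-annihilators : ∀ ns {a o} → IsOrder ns a o → ∀ q → ∑< (q * o) (λ i → 𝟙 (MulZero? ns (suc i) a)) ≡ q
  count-annihilators ns isOrder@(o>0 , _) q =
    trans (∑<-cong (q * _) (λ i → 𝟙-cong _ _ (MulZero⇔order-∣ ns isOrder)))
          (count-positive-multiples _ {{>-nonZero o>0}} q)

  sum-kernel-sizes : ∀ ns → All (0 <_) ns → ∀ L (ord q : Grp ns → ℕ) →
                     (∀ a → IsOrder ns a (ord a)) → (∀ a → L ≡ q a * ord a) →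
                     ∑< L (λ i → gcdProd (suc i) ns) ≡ sum (map q (elems ns))
  sum-kernel-sizes ns ns>0 L ord q isOrder L≡q*ord = begin
    ∑< L (λ i → gcdProd (suc i) ns)
      ≡⟨ ∑<-cong L (λ i → sym (kernel-size ns ns>0 (suc i))) ⟩
    ∑< L (λ i → sum (map (χ i) (elems ns)))
      ≡⟨ ∑<-sum-comm L χ (elems ns) ⟩
    sum (map (λ a → ∑< L (λ i → χ i a)) (elems ns))
      ≡⟨ cong sum (map-cong annihilators (elems ns)) ⟩
    sum (map q (elems ns)) ∎
    where
      χ : ℕ → Grp ns → ℕ
      χ i a = 𝟙 (MulZero? ns (suc i) a)
      annihilators : ∀ a → ∑< L (λ i → χ i a) ≡ q a
      annihilators a = trans (cong (λ k → ∑< k (λ i → χ i a)) (L≡q*ord a))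
                             (count-annihilators ns (isOrder a) (q a))

  lcm-pos : ∀ {m n} → 0 < m → 0 < n → 0 < lcm m n
  lcm-pos {m@(suc _)} {n@(suc _)} _ _ = n≢0⇒n>0 λ lcm≡0 → 1+n≢0 (begin
    m * n               ≡⟨ gcd*lcm m n ⟨
    gcd m n * lcm m n   ≡⟨ cong (gcd m n *_) lcm≡0 ⟩
    gcd m n * 0         ≡⟨ *-zeroʳ (gcd m n) ⟩
    0                   ∎)

  lcmList-pos : ∀ {ns} → All (0 <_) ns → 0 < lcmList ns
  lcmList-pos []           = z<s
  lcmList-pos (n>0 ∷ ns>0) = lcm-pos n>0 (lcmList-pos ns>0)

import Data.Nat as ℕ
open import Data.Nat using (ℕ; zero; suc; _<_)
open import Data.Nat.Divisibility using (_∣_; quotient; m∣n⇒n≡quotient*m)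
open import Data.Nat.Coprimality as Coprimality using (1-coprimeTo)
open import Data.Nat.ListAction using (sum)
import Data.Nat.Properties as ℕ
open import Data.Integer as ℤ using (+_)
import Data.Integer.Properties as ℤ
open import Data.Rational using (ℚ; mkℚ; _/_; _+_; _*_)
open import Data.Rational.Properties using (fromℚᵘ-toℚᵘ; fromℚᵘ-cong; *-distribˡ-+; *-zeroʳ)
open import Data.Rational.Unnormalised using (mkℚᵘ; *≡*)
open Counting using (∑<; lcmList-pos; order-∣; MulZero-lcmList; sum-kernel-sizes)
open ≡-Reasoning

ι : ℕ → ℚ
ι n = + n / 1

-- `_/_` normalises through gcd, which does not reduce on variables.
ι-normal : ∀ n → ι n ≡ mkℚ (+ n) 0 (Coprimality.sym (1-coprimeTo n))
ι-normal n = fromℚᵘ-toℚᵘ (mkℚ (+ n) 0 _)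

inv-normal : ∀ n → inv (suc n) ≡ mkℚ (+ 1) n (1-coprimeTo (suc n))
inv-normal n = fromℚᵘ-toℚᵘ (mkℚ (+ 1) n _)

ι-+ : ∀ m n → ι (m ℕ.+ n) ≡ ι m + ι n
ι-+ m n = sym (begin
  ι m + ι n
    ≡⟨ cong₂ _+_ (ι-normal m) (ι-normal n) ⟩
  (+ m ℤ.* + 1 ℤ.+ + n ℤ.* + 1) / 1
    ≡⟨ cong (_/ 1) (cong₂ ℤ._+_ (ℤ.*-identityʳ (+ m)) (ℤ.*-identityʳ (+ n))) ⟩
  (+ m ℤ.+ + n) / 1
    ≡⟨ cong (_/ 1) (ℤ.pos-+ m n) ⟨
  ι (m ℕ.+ n) ∎)

sumℚ-applyUpTo-ι : ∀ n (f : ℕ → ℕ) → sumℚ (applyUpTo (ι ∘ f) n) ≡ ι (∑< n f)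
sumℚ-applyUpTo-ι zero    f = refl
sumℚ-applyUpTo-ι (suc n) f = trans (cong (_+_ (ι (f 0))) (sumℚ-applyUpTo-ι n (f ∘ suc))) (sym (ι-+ (f 0) _))

sumℚ-map-ι : ∀ {a} {A : Set a} (f : A → ℕ) xs → sumℚ (map (ι ∘ f) xs) ≡ ι (sum (map f xs))
sumℚ-map-ι f []       = refl
sumℚ-map-ι f (x ∷ xs) = trans (cong (_+_ (ι (f x))) (sumℚ-map-ι f xs)) (sym (ι-+ (f x) _))

*-distribˡ-sumℚ : ∀ {a} {A : Set a} c (f : A → ℚ) xs → c * sumℚ (map f xs) ≡ sumℚ (map (λ x → c * f x) xs)
*-distribˡ-sumℚ c f []       = *-zeroʳ c
*-distribˡ-sumℚ c f (x ∷ xs) = trans (*-distribˡ-+ c (f x) _) (cong (_+_ (c * f x)) (*-distribˡ-sumℚ c f xs))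

inv-*-ι : ∀ {L o q} → 0 < L → 0 < o → q ℕ.* o ≡ L → inv L * ι q ≡ inv o
inv-*-ι {suc L} {suc o} {q} _ _ q*o≡L = begin
  inv (suc L) * ι q
    ≡⟨ cong₂ _*_ (inv-normal L) (ι-normal q) ⟩
  (+ 1 ℤ.* + q) / (suc L ℕ.* 1)
    ≡⟨ fromℚᵘ-cong {mkℚᵘ (+ 1 ℤ.* + q) (L ℕ.* 1)} {mkℚᵘ (+ 1) o} (*≡* cross-multiplied) ⟩
  inv (suc o) ∎
  where
    cross-multiplied : (+ 1 ℤ.* + q) ℤ.* + suc o ≡ + 1 ℤ.* + (suc L ℕ.* 1)
    cross-multiplied = begin
      (+ 1 ℤ.* + q) ℤ.* + suc o ≡⟨ cong (ℤ._* + suc o) (ℤ.*-identityˡ (+ q)) ⟩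
      + q ℤ.* + suc o           ≡⟨ ℤ.pos-* q (suc o) ⟨
      + (q ℕ.* suc o)           ≡⟨ cong +_ (trans q*o≡L (sym (ℕ.*-identityʳ (suc L)))) ⟩
      + (suc L ℕ.* 1)           ≡⟨ ℤ.*-identityˡ (+ (suc L ℕ.* 1)) ⟨
      + 1 ℤ.* + (suc L ℕ.* 1)   ∎

theorem1p5 : (ns : List ℕ) → All (0 <_) ns →
             (ord : Grp ns → ℕ) → (∀ a → IsOrder ns a (ord a)) →
             inv (lcmList ns) * lhsSum ns ≡ sumℚ (map (λ a → inv (ord a)) (elems ns))
theorem1p5 ns ns>0 ord isOrder = begin
  inv L * lhsSum ns
    ≡⟨ cong (inv L *_) (sumℚ-applyUpTo-ι L (λ i → gcdProd (suc i) ns)) ⟩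
  inv L * ι (∑< L (λ i → gcdProd (suc i) ns))
    ≡⟨ cong (λ s → inv L * ι s) (sum-kernel-sizes ns ns>0 L ord L/ord isOrder (m∣n⇒n≡quotient*m ∘ ord∣L)) ⟩
  inv L * ι (sum (map L/ord (elems ns)))
    ≡⟨ cong (inv L *_) (sumℚ-map-ι L/ord (elems ns)) ⟨
  inv L * sumℚ (map (ι ∘ L/ord) (elems ns))
    ≡⟨ *-distribˡ-sumℚ (inv L) (ι ∘ L/ord) (elems ns) ⟩
  sumℚ (map (λ a → inv L * ι (L/ord a)) (elems ns))
    ≡⟨ cong sumℚ (map-cong inv-L*L/ord≡inv-ord (elems ns)) ⟩
  sumℚ (map (λ a → inv (ord a)) (elems ns)) ∎
  where
    L : ℕ
    L = lcmList ns
    ord∣L : ∀ a → ord a ∣ L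
    ord∣L a = order-∣ ns (isOrder a) (MulZero-lcmList ns a)
    L/ord : Grp ns → ℕ
    L/ord a = quotient (ord∣L a)
    inv-L*L/ord≡inv-ord : ∀ a → inv L * ι (L/ord a) ≡ inv (ord a)
    inv-L*L/ord≡inv-ord a = inv-*-ι {q = L/ord a} (lcmList-pos ns>0) (proj₁ (isOrder a)) (sym (m∣n⇒n≡quotient*m (ord∣L a)))
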